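{- Let $n>1$ be an integer and $d>1$ a proper divisor of $n$. Let $p_1 = f(n)$, $p_i = f\left(\frac{n}{d}\right)$, and let $Q$ be the set of prime divisors of $n$ that do not divide $d$. If $Q$ is empty, or if $q := \min_{p\in Q} p$ satisfies $q > p_1\cdot p_i$, then $\omega(X_n(1,d)) = p_1\cdot p_i$.
   Context: For an integer $n>1$ and a set $D$ of positive proper divisors of $n$, the gcd-graph $X_n(D)$ has vertex set $\mathbb{Z}_n=\{0,1,\ldots,n-1\}$, and two distinct vertices $a,b$ are adjacent if and only if $\gcd(a-b,n)\in D$; $X_n(1,d)$ denotes $X_n(\{1,d\})$. For an integer $m>1$, $f(m)$ denotes the smallest prime divisor of $m$. $\omega$ denotes the clique number. -}

module Defs where

open import Data.Nat using (ℕ; _≤_; _<_; _*_; _∸_)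
open import Data.Nat.Divisibility using (_∣_)
open import Data.Nat.GCD using (gcd)
open import Data.Nat.Primality using (Prime)
open import Data.Fin using (Fin; toℕ)
open import Data.List using (List; length)
open import Data.List.Relation.Unary.Unique.Propositional using (Unique)
open import Data.List.Membership.Propositional using (_∈_)
open import Data.Product using (_×_; ∃)
open import Data.Sum using (_⊎_)
open import Relation.Binary.PropositionalEquality using (_≡_)
open import Relation.Nullary using (¬_)

absDiff : ℕ → ℕ → ℕ
absDiff a b = (a ∸ b) Data.Nat.+ (b ∸ a)

-- gcd-graph X_n(D) with D = {1, d}: vertices Z_n = Fin n;
-- distinct a, b adjacent iff gcd(a - b, n) ∈ {1, d}.
-- (gcd(a-b, n) = gcd(|a-b|, n) for representatives in {0..n-1}.)
Adj : (n d : ℕ) → Fin n → Fin n → Set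
Adj n d a b = ¬ (a ≡ b) ×
  (gcd (absDiff (toℕ a) (toℕ b)) n ≡ 1 ⊎ gcd (absDiff (toℕ a) (toℕ b)) n ≡ d)

IsClique : (n d : ℕ) → List (Fin n) → Set
IsClique n d xs = Unique xs × (∀ {a b} → a ∈ xs → b ∈ xs → ¬ (a ≡ b) → Adj n d a b)

CliqueNumber : (n d k : ℕ) → Set
CliqueNumber n d k =
  (∃ λ xs → IsClique n d xs × length xs ≡ k) ×
  (∀ xs → IsClique n d xs → length xs ≤ k)

IsSmallestPrimeDivisor : ℕ → ℕ → Set
IsSmallestPrimeDivisor m p = Prime p × p ∣ m × (∀ q → Prime q → q ∣ m → p ≤ q)

InQ : ℕ → ℕ → ℕ → Set
InQ n d q = Prime q × q ∣ n × ¬ (q ∣ d)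

IsMinQ : ℕ → ℕ → ℕ → Set
IsMinQ n d q = InQ n d q × (∀ r → InQ n d r → q ≤ r)

module Submission where

-- Upper bound: two vertices of a clique cannot agree both modulo p₁ and, after division by d,
-- modulo pᵢ.  Agreement modulo p₁ puts p₁ into the gcd, excluding gcd 1; agreement in both
-- puts pᵢ·d into the gcd, excluding gcd d.  So a clique injects into Z_p₁ × Z_pᵢ.
-- Lower bound: let B be the product of the k ≤ n coprime to d, so that no prime of d divides B
-- but every prime of Q does.  Writing t < p₁·pᵢ as t = i·pᵢ + j, the vertices B·i + d·t (mod n)
-- form a clique.  Within a block (same i) the difference is d·(j − j′) with |j − j′| < pᵢ, so
-- the gcd is exactly d.  Across blocks, a prime r of the gcd dividing d would divide B·(i − i′),
-- impossible as 0 < |i − i′| < p₁ ≤ r; a prime r in Q would divide d·(t − t′), impossible as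
-- 0 < |t − t′| < p₁·pᵢ < q ≤ r.  So the gcd is 1.

open import Defs
open import Data.Nat
open import Data.Nat.Properties
open import Data.Nat.Divisibility
open import Data.Nat.DivMod
open import Data.Nat.GCD
open import Data.Nat.Coprimality using (Coprime; coprime?; coprime-divisor)
open import Data.Nat.Primality
open import Data.Nat.Primality.Factorisation using (factorise)
open import Data.Nat.ListAction using (product)
open import Data.Fin as Fin using (Fin; toℕ; combine; remQuot)
open import Data.Fin.Properties using (toℕ-fromℕ<; remQuot-combine; injective⇒≤)
open import Data.List using (List; []; _∷_; length; lookup; applyUpTo)
open import Data.List.Properties using (length-applyUpTo)
open import Data.List.Relation.Unary.All as All using (_∷_)
open import Data.List.Relation.Unary.AllPairs using (_∷_)
open import Data.List.Relation.Unary.Unique.Propositional using (Unique)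
open import Data.List.Relation.Unary.Unique.Propositional.Properties using (applyUpTo⁺₁)
open import Data.List.Membership.Propositional using (_∈_)
open import Data.List.Membership.Propositional.Properties using (∈-lookup; ∈-applyUpTo⁻)
open import Data.Product using (_×_; ∃; _,_; proj₁; proj₂)
open import Data.Product.Properties using (,-injective)
open import Data.Sum using (_⊎_; inj₁; inj₂; [_,_]′)
open import Data.Empty using (⊥-elim)
open import Function using (case_of_)
open import Relation.Nullary using (¬_; yes; no; contradiction)
open import Relation.Binary.PropositionalEquality
  using (_≡_; _≢_; refl; sym; trans; cong; cong₂; subst; module ≡-Reasoning)

absDiff≡∣-∣ : ∀ a b → absDiff a b ≡ ∣ a - b ∣
absDiff≡∣-∣ zero    zero    = refl
absDiff≡∣-∣ zero    (suc b) = refl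
absDiff≡∣-∣ (suc a) zero    = +-identityʳ (suc a)
absDiff≡∣-∣ (suc a) (suc b) = absDiff≡∣-∣ a b

module _ {m : ℕ} .{{_ : NonZero m}} where

  %≡%⇒∣-∣≡∣/-/∣* : ∀ {x y} → x % m ≡ y % m → ∣ x - y ∣ ≡ ∣ x / m - y / m ∣ * m
  %≡%⇒∣-∣≡∣/-/∣* {x} {y} x≡y = begin
    ∣ x - y ∣                                      ≡⟨ cong₂ ∣_-_∣ (m≡m%n+[m/n]*n x m) (m≡m%n+[m/n]*n y m) ⟩
    ∣ x % m + x / m * m - y % m + y / m * m ∣      ≡⟨ cong (λ z → ∣ x % m + x / m * m - z + y / m * m ∣) x≡y ⟨
    ∣ x % m + x / m * m - x % m + y / m * m ∣      ≡⟨ ∣m+n-m+o∣≡∣n-o∣ (x % m) _ _ ⟩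
    ∣ x / m * m - y / m * m ∣                      ≡⟨ *-distribʳ-∣-∣ m (x / m) (y / m) ⟨
    ∣ x / m - y / m ∣ * m                          ∎
    where open ≡-Reasoning

  %≡%⇒∣∣-∣ : ∀ {x y} → x % m ≡ y % m → m ∣ ∣ x - y ∣
  %≡%⇒∣∣-∣ {x} {y} x≡y = subst (m ∣_) (sym (%≡%⇒∣-∣≡∣/-/∣* x≡y)) (n∣m*n ∣ x / m - y / m ∣)

  ∣∣-∣⇒%≡% : ∀ {x y} → m ∣ ∣ x - y ∣ → x % m ≡ y % m
  ∣∣-∣⇒%≡% {x} {y} m∣x-y =
    [ (λ x≤y → sym (shift x≤y m∣x-y)) , (λ y≤x → shift y≤x (subst (m ∣_) (∣-∣-comm x y) m∣x-y)) ]′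
      (≤-total x y)
    where
    shift : ∀ {u v} → u ≤ v → m ∣ ∣ u - v ∣ → v % m ≡ u % m
    shift {u} {v} u≤v m∣u-v = begin
      v % m               ≡⟨ cong (_% m) (m+[n∸m]≡n u≤v) ⟨
      (u + (v ∸ u)) % m   ≡⟨ %-remove-+ʳ u (subst (m ∣_) (m≤n⇒∣m-n∣≡n∸m u≤v) m∣u-v) ⟩
      u % m               ∎
      where open ≡-Reasoning

  ∣∣-∣⇒≡ : ∀ {x y} → m ∣ ∣ x - y ∣ → x < m → y < m → x ≡ y
  ∣∣-∣⇒≡ {x} {y} m∣x-y x<m y<m =
    trans (sym (m<n⇒m%n≡m x<m)) (trans (∣∣-∣⇒%≡% m∣x-y) (m<n⇒m%n≡m y<m))

  /≡/⇒∣-∣≡∣%-%∣ : ∀ {x y} → x / m ≡ y / m → ∣ x - y ∣ ≡ ∣ x % m - y % m ∣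
  /≡/⇒∣-∣≡∣%-%∣ {x} {y} x≡y = begin
    ∣ x - y ∣                                    ≡⟨ cong₂ ∣_-_∣ (m≡m%n+[m/n]*n x m) (m≡m%n+[m/n]*n y m) ⟩
    ∣ x % m + x / m * m - y % m + y / m * m ∣    ≡⟨ cong₂ ∣_-_∣ (+-comm (x % m) _) (+-comm (y % m) _) ⟩
    ∣ x / m * m + x % m - y / m * m + y % m ∣    ≡⟨ cong (λ z → ∣ x / m * m + x % m - z * m + y % m ∣) x≡y ⟨
    ∣ x / m * m + x % m - x / m * m + y % m ∣    ≡⟨ ∣m+n-m+o∣≡∣n-o∣ (x / m * m) _ _ ⟩
    ∣ x % m - y % m ∣                            ∎
    where open ≡-Reasoning

  mod≡⇒%≡ : ∀ {x y} → x mod m ≡ y mod m → x % m ≡ y % m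
  mod≡⇒%≡ {x} {y} x≡y =
    trans (sym (toℕ-fromℕ< (m%n<n x m))) (trans (cong toℕ x≡y) (toℕ-fromℕ< (m%n<n y m)))

module _ {c n : ℕ} .{{_ : NonZero c}} .{{_ : NonZero n}} (c∣n : c ∣ n) where

  ∣∣%-%∣⇒%≡% : ∀ {x y} → c ∣ ∣ x % n - y % n ∣ → x % c ≡ y % c
  ∣∣%-%∣⇒%≡% {x} {y} c∣x-y = begin
    x % c       ≡⟨ m∣n⇒o%n%m≡o%m c n x c∣n ⟨
    x % n % c   ≡⟨ ∣∣-∣⇒%≡% c∣x-y ⟩
    y % n % c   ≡⟨ m∣n⇒o%n%m≡o%m c n y c∣n ⟩
    y % c       ∎
    where open ≡-Reasoning

  %≡%⇒∣∣%-%∣ : ∀ {x y} → x % c ≡ y % c → c ∣ ∣ x % n - y % n ∣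
  %≡%⇒∣∣%-%∣ {x} {y} x≡y = %≡%⇒∣∣-∣ (begin
    x % n % c   ≡⟨ m∣n⇒o%n%m≡o%m c n x c∣n ⟩
    x % c       ≡⟨ x≡y ⟩
    y % c       ≡⟨ m∣n⇒o%n%m≡o%m c n y c∣n ⟨
    y % n % c   ∎)
    where open ≡-Reasoning

no-prime-divisor⇒≡1 : ∀ {g} .{{_ : NonZero g}} → (∀ {r} → Prime r → r ∤ g) → g ≡ 1
no-prime-divisor⇒≡1 {g} no-divisor with factorise g
... | record { factors = [] ; isFactorisation = g≡1 } = g≡1
... | record { factors = r ∷ rs ; isFactorisation = g≡r*rs ; factorsPrime = r-prime ∷ _ } =
  contradiction (subst (r ∣_) (sym g≡r*rs) (m∣m*n (product rs))) (no-divisor r-prime)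

no-prime-multiple⇒≡ : ∀ {g d} .{{_ : NonZero g}} → d ∣ g → (∀ {r} → Prime r → r * d ∤ g) → g ≡ d
no-prime-multiple⇒≡ {g} {d} d∣g@(divides h g≡h*d) no-multiple = begin
  g       ≡⟨ g≡h*d ⟩
  h * d   ≡⟨ cong (_* d) h≡1 ⟩
  1 * d   ≡⟨ *-identityˡ d ⟩
  d       ∎
  where
  open ≡-Reasoning
  instance _ = quotient≢0 d∣g
  h≡1 : h ≡ 1
  h≡1 = no-prime-divisor⇒≡1 λ r-prime r∣h →
    no-multiple r-prime (subst (_ ∣_) (sym g≡h*d) (*-monoˡ-∣ d r∣h))

prime∤⇒coprime : ∀ {r d} → Prime r → r ∤ d → Coprime r d
prime∤⇒coprime r-prime r∤d (c∣r , c∣d) with prime⇒irreducible r-prime c∣r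
... | inj₁ c≡1 = c≡1
... | inj₂ refl = contradiction c∣d r∤d

coprimeProduct : ℕ → ℕ → ℕ
coprimeProduct d zero = 1
coprimeProduct d (suc k) with coprime? k d
... | yes _ = k * coprimeProduct d k
... | no _  = coprimeProduct d k

prime∣⇒∤coprimeProduct : ∀ {r d} k → Prime r → r ∣ d → r ∤ coprimeProduct d k
prime∣⇒∤coprimeProduct zero r-prime _ r∣1 = ¬prime[1] (subst Prime (∣1⇒≡1 r∣1) r-prime)
prime∣⇒∤coprimeProduct {d = d} (suc k) r-prime r∣d r∣P with coprime? k d
... | no _ = prime∣⇒∤coprimeProduct k r-prime r∣d r∣P
... | yes k⊥d with euclidsLemma k (coprimeProduct d k) r-prime r∣P
...   | inj₁ r∣k = ¬prime[1] (subst Prime (k⊥d (r∣k , r∣d)) r-prime)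
...   | inj₂ r∣P′ = prime∣⇒∤coprimeProduct k r-prime r∣d r∣P′

prime∤⇒∣coprimeProduct : ∀ {r d} k → Prime r → r ∤ d → r < k → r ∣ coprimeProduct d k
prime∤⇒∣coprimeProduct {r} {d} (suc k) r-prime r∤d r<1+k with coprime? k d | r ≟ k
... | yes _   | yes refl = m∣m*n (coprimeProduct d k)
... | no ¬r⊥d | yes refl = ⊥-elim (¬r⊥d (prime∤⇒coprime r-prime r∤d))
... | yes _   | no r≢k   = ∣n⇒∣m*n k (prime∤⇒∣coprimeProduct k r-prime r∤d (≤∧≢⇒< (s≤s⁻¹ r<1+k) r≢k))
... | no _    | no r≢k   = prime∤⇒∣coprimeProduct k r-prime r∤d (≤∧≢⇒< (s≤s⁻¹ r<1+k) r≢k)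

Unique⇒lookup-injective : ∀ {A : Set} {xs : List A} → Unique xs →
  ∀ {i j} → lookup xs i ≡ lookup xs j → i ≡ j
Unique⇒lookup-injective {xs = _ ∷ _} _ {Fin.zero} {Fin.zero} _ = refl
Unique⇒lookup-injective {xs = _ ∷ _} (x∉xs ∷ _) {Fin.zero} {Fin.suc j} x≡xsⱼ =
  contradiction x≡xsⱼ (All.lookup x∉xs (∈-lookup j))
Unique⇒lookup-injective {xs = _ ∷ _} (x∉xs ∷ _) {Fin.suc i} {Fin.zero} xsᵢ≡x =
  contradiction (sym xsᵢ≡x) (All.lookup x∉xs (∈-lookup i))
Unique⇒lookup-injective {xs = _ ∷ _} (_ ∷ unique) {Fin.suc i} {Fin.suc j} xsᵢ≡xsⱼ =
  cong Fin.suc (Unique⇒lookup-injective unique xsᵢ≡xsⱼ)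

Unique⇒length≤ : ∀ {A : Set} {m} {xs : List A} (f : A → Fin m) →
  (∀ {x y} → x ∈ xs → y ∈ xs → f x ≡ f y → x ≡ y) → Unique xs → length xs ≤ m
Unique⇒length≤ f f-injective unique = injective⇒≤ λ {i} {j} fxsᵢ≡fxsⱼ →
  Unique⇒lookup-injective unique (f-injective (∈-lookup i) (∈-lookup j) fxsᵢ≡fxsⱼ)

combine-injective : ∀ {m n} {i i′ : Fin m} {j j′ : Fin n} →
  combine i j ≡ combine i′ j′ → i ≡ i′ × j ≡ j′
combine-injective {n = n} {i} {i′} {j} {j′} eq = ,-injective (begin
  (i , j)                         ≡⟨ remQuot-combine i j ⟨
  remQuot n (combine i j)         ≡⟨ cong (remQuot n) eq ⟩
  remQuot n (combine i′ j′)       ≡⟨ remQuot-combine i′ j′ ⟩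
  (i′ , j′)                       ∎)
  where open ≡-Reasoning

EdgeDifference : ℕ → ℕ → ℕ → Set
EdgeDifference n d z = gcd z n ≡ 1 ⊎ gcd z n ≡ d

¬EdgeDifference[0] : ∀ {n d} → 1 < n → d < n → ¬ EdgeDifference n d 0
¬EdgeDifference[0] {n} 1<n d<n =
  [ (λ n≡1 → <⇒≢ 1<n (sym (trans (sym (gcd-identityˡ n)) n≡1)))
  , (λ n≡d → <⇒≢ d<n (sym (trans (sym (gcd-identityˡ n)) n≡d))) ]′

applyUpTo-isClique : ∀ {n d N} (v : ℕ → Fin n) → 1 < n → d < n →
  (∀ {t t′} → t < N → t′ < N → t ≢ t′ → EdgeDifference n d ∣ toℕ (v t) - toℕ (v t′) ∣) →
  IsClique n d (applyUpTo v N)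
applyUpTo-isClique {n} {d} {N} v 1<n d<n edge = applyUpTo⁺₁ v N distinct , adjacent
  where
  distinct : ∀ {t t′} → t < t′ → t′ < N → v t ≢ v t′
  distinct {t} {t′} t<t′ t′<N vt≡vt′ = ¬EdgeDifference[0] 1<n d<n
    (subst (EdgeDifference n d) (trans (cong (λ a → ∣ toℕ a - toℕ (v t′) ∣) vt≡vt′) (∣n-n∣≡0 (toℕ (v t′))))
      (edge (<-trans t<t′ t′<N) t′<N (<⇒≢ t<t′)))
  adjacent : ∀ {a b} → a ∈ applyUpTo v N → b ∈ applyUpTo v N → a ≢ b → Adj n d a b
  adjacent a∈ b∈ a≢b with ∈-applyUpTo⁻ v a∈ | ∈-applyUpTo⁻ v b∈
  ... | t , t<N , refl | t′ , t′<N , refl =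
    a≢b , subst (EdgeDifference n d) (sym (absDiff≡∣-∣ (toℕ (v t)) (toℕ (v t′))))
            (edge t<N t′<N (λ t≡t′ → a≢b (cong v t≡t′)))

module _ {n d e p r : ℕ} .{{_ : NonZero d}} (n≡d*e : n ≡ d * e) (1<p : 1 < p) (p∣n : p ∣ n)
         (1<r : 1 < r) (r∣e : r ∣ e) where

  ∣-∣∧∣/-/∣⇒¬EdgeDifference : ∀ {x y} → p ∣ ∣ x - y ∣ → r ∣ ∣ x / d - y / d ∣ →
    ¬ EdgeDifference n d ∣ x - y ∣
  ∣-∣∧∣/-/∣⇒¬EdgeDifference p∣x-y _ (inj₁ g≡1) =
    <⇒≢ 1<p (sym (∣1⇒≡1 (subst (p ∣_) g≡1 (gcd-greatest p∣x-y p∣n))))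
  ∣-∣∧∣/-/∣⇒¬EdgeDifference {x} {y} _ r∣x/d-y/d (inj₂ g≡d) = >⇒∤ d<r*d r*d∣d
    where
    d∣x-y : d ∣ ∣ x - y ∣
    d∣x-y = subst (_∣ ∣ x - y ∣) g≡d (gcd[m,n]∣m ∣ x - y ∣ n)
    r*d∣x-y : r * d ∣ ∣ x - y ∣
    r*d∣x-y = subst (r * d ∣_) (sym (%≡%⇒∣-∣≡∣/-/∣* (∣∣-∣⇒%≡% d∣x-y))) (*-monoˡ-∣ d r∣x/d-y/d)
    r*d∣n : r * d ∣ n
    r*d∣n = subst (r * d ∣_) (trans (*-comm e d) (sym n≡d*e)) (*-monoˡ-∣ d r∣e)
    r*d∣d : r * d ∣ d
    r*d∣d = subst (r * d ∣_) g≡d (gcd-greatest r*d∣x-y r*d∣n)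
    d<r*d : d < r * d
    d<r*d = subst (d <_) (*-comm d r) (m<m*n d r 1<r)

  clique-length≤ : ∀ xs → IsClique n d xs → length xs ≤ p * r
  clique-length≤ xs (unique , adjacent) = Unique⇒length≤ residues residues-injective unique
    where
    instance
      _ = nonTrivial⇒nonZero p {{n>1⇒nonTrivial 1<p}}
      _ = nonTrivial⇒nonZero r {{n>1⇒nonTrivial 1<r}}
    residues : Fin n → Fin (p * r)
    residues a = combine (toℕ a mod p) (toℕ a / d mod r)
    residues-injective : ∀ {a b} → a ∈ xs → b ∈ xs → residues a ≡ residues b → a ≡ b
    residues-injective {a} {b} a∈xs b∈xs residues≡ with a Fin.≟ b
    ... | yes a≡b = a≡b
    ... | no a≢b = contradiction
      (subst (EdgeDifference n d) (absDiff≡∣-∣ (toℕ a) (toℕ b)) (proj₂ (adjacent a∈xs b∈xs a≢b)))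
      (∣-∣∧∣/-/∣⇒¬EdgeDifference (%≡%⇒∣∣-∣ (mod≡⇒%≡ (proj₁ components≡)))
                                  (%≡%⇒∣∣-∣ (mod≡⇒%≡ (proj₂ components≡))))
      where
      components≡ : toℕ a mod p ≡ toℕ b mod p × toℕ a / d mod r ≡ toℕ b / d mod r
      components≡ = combine-injective residues≡

module LargeClique {n d e p₁ pᵢ : ℕ} .{{_ : NonZero n}} .{{_ : NonZero d}} .{{_ : NonZero pᵢ}}
  (n≡d*e : n ≡ d * e)
  (p₁≤ : ∀ {r} → Prime r → r ∣ n → p₁ ≤ r)
  (pᵢ≤ : ∀ {r} → Prime r → r ∣ e → pᵢ ≤ r)
  (Q>p₁*pᵢ : ∀ {r} → InQ n d r → p₁ * pᵢ < r)
  where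

  B : ℕ
  B = coprimeProduct d (suc n)

  label : ℕ → ℕ
  label t = B * (t / pᵢ) + d * t

  vertex : ℕ → Fin n
  vertex t = label t mod n

  labelGcd : ℕ → ℕ → ℕ
  labelGcd t t′ = gcd ∣ label t % n - label t′ % n ∣ n

  instance
    labelGcd≢0 : ∀ {t t′} → NonZero (labelGcd t t′)
    labelGcd≢0 {t} {t′} = ≢-nonZero (gcd[m,n]≢0 ∣ label t % n - label t′ % n ∣ n (inj₂ (≢-nonZero⁻¹ n)))

  d∣n : d ∣ n
  d∣n = subst (d ∣_) (sym n≡d*e) (m∣m*n e)

  ∣labelGcd⇒∣n : ∀ {c t t′} → c ∣ labelGcd t t′ → c ∣ n
  ∣labelGcd⇒∣n {t = t} {t′} c∣g = ∣-trans c∣g (gcd[m,n]∣n ∣ label t % n - label t′ % n ∣ n)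

  ∣labelGcd⇒label≡ : ∀ {c t t′} .{{_ : NonZero c}} → c ∣ labelGcd t t′ → label t % c ≡ label t′ % c
  ∣labelGcd⇒label≡ {t = t} {t′} c∣g =
    ∣∣%-%∣⇒%≡% (∣labelGcd⇒∣n {t = t} c∣g) (∣-trans c∣g (gcd[m,n]∣m ∣ label t % n - label t′ % n ∣ n))

  label≡[mod∣d] : ∀ {c} .{{_ : NonZero c}} → c ∣ d → ∀ t → label t % c ≡ B * (t / pᵢ) % c
  label≡[mod∣d] c∣d t = %-remove-+ʳ (B * (t / pᵢ)) (∣m⇒∣m*n t c∣d)

  label≡[mod∣B] : ∀ {c} .{{_ : NonZero c}} → c ∣ B → ∀ t → label t % c ≡ d * t % c
  label≡[mod∣B] c∣B t = %-remove-+ˡ (d * t) (∣m⇒∣m*n (t / pᵢ) c∣B)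

  sameBlock⇒∣label-label∣ : ∀ {t t′} → t / pᵢ ≡ t′ / pᵢ → ∣ label t - label t′ ∣ ≡ d * ∣ t - t′ ∣
  sameBlock⇒∣label-label∣ {t} {t′} i≡i′ = begin
    ∣ B * (t / pᵢ) + d * t - B * (t′ / pᵢ) + d * t′ ∣   ≡⟨ cong (λ i → ∣ B * (t / pᵢ) + d * t - B * i + d * t′ ∣) i≡i′ ⟨
    ∣ B * (t / pᵢ) + d * t - B * (t / pᵢ) + d * t′ ∣    ≡⟨ ∣m+n-m+o∣≡∣n-o∣ (B * (t / pᵢ)) _ _ ⟩
    ∣ d * t - d * t′ ∣                                  ≡⟨ *-distribˡ-∣-∣ d t t′ ⟨
    d * ∣ t - t′ ∣                                      ∎
    where open ≡-Reasoning

  sameBlock⇒d∣labelGcd : ∀ {t t′} → t / pᵢ ≡ t′ / pᵢ → d ∣ labelGcd t t′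
  sameBlock⇒d∣labelGcd {t} {t′} i≡i′ = gcd-greatest (%≡%⇒∣∣%-%∣ d∣n (begin
    label t % d             ≡⟨ label≡[mod∣d] ∣-refl t ⟩
    B * (t / pᵢ) % d        ≡⟨ cong (λ i → B * i % d) i≡i′ ⟩
    B * (t′ / pᵢ) % d       ≡⟨ label≡[mod∣d] ∣-refl t′ ⟨
    label t′ % d            ∎)) d∣n
    where open ≡-Reasoning

  sameBlock∧prime*d∣labelGcd⇒≡ : ∀ {r t t′} → Prime r → t / pᵢ ≡ t′ / pᵢ →
    r * d ∣ labelGcd t t′ → t ≡ t′
  sameBlock∧prime*d∣labelGcd⇒≡ {r} {t} {t′} r-prime i≡i′ r*d∣g =
    ∣m-n∣≡0⇒m≡n (begin
      ∣ t - t′ ∣                 ≡⟨ /≡/⇒∣-∣≡∣%-%∣ i≡i′ ⟩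
      ∣ t % pᵢ - t′ % pᵢ ∣       ≡⟨ cong (λ j → ∣ j - t′ % pᵢ ∣) j≡j′ ⟩
      ∣ t′ % pᵢ - t′ % pᵢ ∣      ≡⟨ ∣n-n∣≡0 (t′ % pᵢ) ⟩
      0                          ∎)
    where
    open ≡-Reasoning
    instance
      _ = prime⇒nonZero r-prime
      _ = m*n≢0 r d
    r∣e : r ∣ e
    r∣e = *-cancelʳ-∣ d (subst (r * d ∣_) (trans n≡d*e (*-comm d e)) (∣labelGcd⇒∣n r*d∣g))
    r∣t-t′ : r ∣ ∣ t - t′ ∣
    r∣t-t′ = *-cancelʳ-∣ d (subst (r * d ∣_) (trans (sameBlock⇒∣label-label∣ i≡i′) (*-comm d _))
                                  (%≡%⇒∣∣-∣ (∣labelGcd⇒label≡ r*d∣g)))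
    j≡j′ : t % pᵢ ≡ t′ % pᵢ
    j≡j′ = ∣∣-∣⇒≡ (subst (r ∣_) (/≡/⇒∣-∣≡∣%-%∣ i≡i′) r∣t-t′)
                  (<-≤-trans (m%n<n t pᵢ) (pᵢ≤ r-prime r∣e)) (<-≤-trans (m%n<n t′ pᵢ) (pᵢ≤ r-prime r∣e))

  prime∣d∧prime∣labelGcd⇒sameBlock : ∀ {r t t′} → Prime r → r ∣ d → t < p₁ * pᵢ → t′ < p₁ * pᵢ →
    r ∣ labelGcd t t′ → t / pᵢ ≡ t′ / pᵢ
  prime∣d∧prime∣labelGcd⇒sameBlock {r} {t} {t′} r-prime r∣d t<N t′<N r∣g =
    ∣∣-∣⇒≡ r∣i-i′ (<-≤-trans (m<n*o⇒m/o<n t<N) p₁≤r) (<-≤-trans (m<n*o⇒m/o<n t′<N) p₁≤r)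
    where
    instance _ = prime⇒nonZero r-prime
    p₁≤r : p₁ ≤ r
    p₁≤r = p₁≤ r-prime (∣labelGcd⇒∣n {t = t} r∣g)
    r∣B*[i-i′] : r ∣ B * ∣ t / pᵢ - t′ / pᵢ ∣
    r∣B*[i-i′] = subst (r ∣_) (sym (*-distribˡ-∣-∣ B (t / pᵢ) (t′ / pᵢ))) (%≡%⇒∣∣-∣ (begin
      B * (t / pᵢ) % r     ≡⟨ label≡[mod∣d] r∣d t ⟨
      label t % r          ≡⟨ ∣labelGcd⇒label≡ r∣g ⟩
      label t′ % r         ≡⟨ label≡[mod∣d] r∣d t′ ⟩
      B * (t′ / pᵢ) % r    ∎))
      where open ≡-Reasoning
    r∣i-i′ : r ∣ ∣ t / pᵢ - t′ / pᵢ ∣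
    r∣i-i′ = coprime-divisor (prime∤⇒coprime r-prime (prime∣⇒∤coprimeProduct (suc n) r-prime r∣d))
                             r∣B*[i-i′]

  prime∤d∧prime∣labelGcd⇒≡ : ∀ {r t t′} → Prime r → r ∤ d → t < p₁ * pᵢ → t′ < p₁ * pᵢ →
    r ∣ labelGcd t t′ → t ≡ t′
  prime∤d∧prime∣labelGcd⇒≡ {r} {t} {t′} r-prime r∤d t<N t′<N r∣g =
    ∣∣-∣⇒≡ r∣t-t′ (<-trans t<N N<r) (<-trans t′<N N<r)
    where
    instance _ = prime⇒nonZero r-prime
    r∣n : r ∣ n
    r∣n = ∣labelGcd⇒∣n {t = t} r∣g
    N<r : p₁ * pᵢ < r
    N<r = Q>p₁*pᵢ (r-prime , r∣n , r∤d)
    r∣B : r ∣ B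
    r∣B = prime∤⇒∣coprimeProduct (suc n) r-prime r∤d (s≤s (∣⇒≤ r∣n))
    r∣d*[t-t′] : r ∣ d * ∣ t - t′ ∣
    r∣d*[t-t′] = subst (r ∣_) (sym (*-distribˡ-∣-∣ d t t′)) (%≡%⇒∣∣-∣ (begin
      d * t % r        ≡⟨ label≡[mod∣B] r∣B t ⟨
      label t % r      ≡⟨ ∣labelGcd⇒label≡ r∣g ⟩
      label t′ % r     ≡⟨ label≡[mod∣B] r∣B t′ ⟩
      d * t′ % r       ∎))
      where open ≡-Reasoning
    r∣t-t′ : r ∣ ∣ t - t′ ∣
    r∣t-t′ = coprime-divisor (prime∤⇒coprime r-prime r∤d) r∣d*[t-t′]

  label-EdgeDifference : ∀ {t t′} → t < p₁ * pᵢ → t′ < p₁ * pᵢ → t ≢ t′ →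
    EdgeDifference n d ∣ label t % n - label t′ % n ∣
  label-EdgeDifference {t} {t′} t<N t′<N t≢t′ with t / pᵢ ≟ t′ / pᵢ
  ... | yes i≡i′ = inj₂ (no-prime-multiple⇒≡ (sameBlock⇒d∣labelGcd i≡i′) λ r-prime r*d∣g →
    t≢t′ (sameBlock∧prime*d∣labelGcd⇒≡ r-prime i≡i′ r*d∣g))
  ... | no i≢i′ = inj₁ (no-prime-divisor⇒≡1 λ {r} r-prime r∣g → case r ∣? d of λ where
    (yes r∣d) → i≢i′ (prime∣d∧prime∣labelGcd⇒sameBlock r-prime r∣d t<N t′<N r∣g)
    (no r∤d)  → t≢t′ (prime∤d∧prime∣labelGcd⇒≡ r-prime r∤d t<N t′<N r∣g))

  clique : 1 < n → d < n → ∃ λ xs → IsClique n d xs × length xs ≡ p₁ * pᵢ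
  clique 1<n d<n =
    applyUpTo vertex (p₁ * pᵢ) ,
    applyUpTo-isClique vertex 1<n d<n edge ,
    length-applyUpTo vertex (p₁ * pᵢ)
    where
    toℕ-vertex : ∀ t → toℕ (vertex t) ≡ label t % n
    toℕ-vertex t = toℕ-fromℕ< (m%n<n (label t) n)
    edge : ∀ {t t′} → t < p₁ * pᵢ → t′ < p₁ * pᵢ → t ≢ t′ →
      EdgeDifference n d ∣ toℕ (vertex t) - toℕ (vertex t′) ∣
    edge {t} {t′} t<N t′<N t≢t′ =
      subst (EdgeDifference n d) (sym (cong₂ ∣_-_∣ (toℕ-vertex t) (toℕ-vertex t′))) (label-EdgeDifference t<N t′<N t≢t′)

theorem3p4 : (n d e : ℕ) → 1 < n → 1 < d → d < n → n ≡ d * e →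
    (p₁ pᵢ : ℕ) → IsSmallestPrimeDivisor n p₁ → IsSmallestPrimeDivisor e pᵢ →
    ((∀ q → ¬ InQ n d q) ⊎ (∃ λ q → IsMinQ n d q × p₁ * pᵢ < q)) →
    CliqueNumber n d (p₁ * pᵢ)
theorem3p4 n d e 1<n 1<d d<n n≡d*e p₁ pᵢ (p₁-prime , p₁∣n , p₁-min) (pᵢ-prime , pᵢ∣e , pᵢ-min) Q-cond =
  LargeClique.clique n≡d*e (λ {r} → p₁-min r) (λ {r} → pᵢ-min r) Q>p₁*pᵢ 1<n d<n ,
  clique-length≤ n≡d*e (prime⇒1< p₁-prime) p₁∣n (prime⇒1< pᵢ-prime) pᵢ∣e
  where
  instance
    _ = >-nonZero (<-trans z<s 1<n)
    _ = >-nonZero (<-trans z<s 1<d)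
    _ = prime⇒nonZero pᵢ-prime
  prime⇒1< : ∀ {p} → Prime p → 1 < p
  prime⇒1< {p} p-prime = nonTrivial⇒n>1 p {{prime⇒nonTrivial p-prime}}
  Q>p₁*pᵢ : ∀ {r} → InQ n d r → p₁ * pᵢ < r
  Q>p₁*pᵢ r∈Q = case Q-cond of λ where
    (inj₁ Q-empty)                    → contradiction r∈Q (Q-empty _)
    (inj₂ (q , (_ , q-min) , p₁*pᵢ<q)) → <-≤-trans p₁*pᵢ<q (q-min _ r∈Q)
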